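{- All strings $x,y,z\in \Sigma^*$ satisfy $\mathsf{dyck}(x\overline{z}) \le \mathsf{dyck}(x\overline{y}y\overline{z})\le \mathsf{dyck}(x\overline{y})+\mathsf{dyck}(y\overline{z})$.
   Context: The alphabet $\Sigma$ is the disjoint union of opening parentheses $T$ and closing parentheses $\overline{T}$ with a bijection $a\mapsto\overline{a}$ from $T$ to $\overline{T}$, extended to an involution of $T\cup\overline{T}$ and then to strings by $\overline{x[1]x[2]\cdots x[n]}=\overline{x[n]}\cdots\overline{x[2]}\,\overline{x[1]}$ (reverse complement). $\mathsf{Dyck}(\Sigma)$ is generated by the grammar $S\to SS\mid\varnothing\mid aS\overline{a}$ ($a\in T$), and $\mathsf{dyck}(x)$ is the minimum number of character insertions, deletions and substitutions transforming $x$ into a string of $\mathsf{Dyck}(\Sigma)$. Juxtaposition denotes concatenation. -}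

module Defs where

open import Data.List using (List; []; _∷_; _++_; reverse; map)
open import Data.Nat using (ℕ; zero; suc; _≤_)
open import Data.Product using (Σ; _×_; ∃)

-- The alphabet Σ = T ⊎ T̄ : opening parentheses `op a` and closing `cl a`.
data Sym (T : Set) : Set where
  op : T → Sym T
  cl : T → Sym T

bar : {T : Set} → Sym T → Sym T
bar (op a) = cl a
bar (cl a) = op a

barStr : {T : Set} → List (Sym T) → List (Sym T)
barStr x = reverse (map bar x)

data Dyck {T : Set} : List (Sym T) → Set where
  dyck-empty  : Dyck []
  dyck-concat : ∀ {u v} → Dyck u → Dyck v → Dyck (u ++ v)
  dyck-wrap   : ∀ (a : T) {u} → Dyck u → Dyck (op a ∷ (u ++ cl a ∷ []))

data EditStep {A : Set} : List A → List A → Set where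
  ins : ∀ u v (c : A)   → EditStep (u ++ v) (u ++ c ∷ v)
  del : ∀ u v (c : A)   → EditStep (u ++ c ∷ v) (u ++ v)
  sub : ∀ u v (c d : A) → EditStep (u ++ c ∷ v) (u ++ d ∷ v)

data Edits {A : Set} : List A → List A → ℕ → Set where
  done : ∀ {x} → Edits x x zero
  step : ∀ {x y w k} → EditStep x y → Edits y w k → Edits x w (suc k)

IsDyckDist : {T : Set} → List (Sym T) → ℕ → Set
IsDyckDist x d =
  (Σ _ λ w → Dyck w × Edits x w d) ×
  (∀ w k → Dyck w → Edits x w k → d ≤ k)

{-# OPTIONS --safe #-}
-- Run st s n says that a stack machine holding the unmatched opening parentheses st can
-- read s making at most n edits; Run [] s n holds exactly when dyck(s) ≤ n, since runs
-- and edit sequences into Dyck(Σ) translate into each other (edits-run, run-within).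
-- Runs concatenate, which gives the upper bound. For the lower bound, cancelling an
-- adjacent pair c̄ c never makes a run more expensive: whatever the run did on c̄ (match
-- it against the stack, substitute or delete it), the inversion lemma for that step,
-- applied to the remaining run, which starts by reading c, yields a run skipping both
-- letters, and the at most one extra edit it needs is paid by the edit spent on c̄.
-- Cancelling the pairs of ȳ y from the middle outwards removes ȳ y.
module Submission where

open import Defs
open import Data.List using (List; []; _∷_; _++_; map)
open import Data.List.Properties using (++-assoc; ++-identityʳ; unfold-reverse)
open import Data.Nat using (ℕ; zero; suc; _+_; _≤_; z≤n; s≤s)
open import Data.Nat.Properties using (≤-trans; +-identityʳ)
open import Data.Product using (_×_; _,_; ∃; ∃₂)
open import Relation.Binary.PropositionalEquality

module _ {T : Set} where

  private
    variable
      st st₁ st₂ : List T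
      s u v w x y : List (Sym T)
      k m n : ℕ
      a b : T
      c d : Sym T

  -- pop-ins a closes a by inserting cl a; pop-resub a b pops a and b by substituting, after
  -- the fact, the op a that pushed a by cl b.  The index n is a budget, see weaken.
  data Run : List T → List (Sym T) → ℕ → Set where
    end       : Run [] [] n
    delete    : ∀ c → Run st s n → Run st (c ∷ s) (suc n)
    push      : ∀ a → Run (a ∷ st) s n → Run st (op a ∷ s) n
    push-sub  : ∀ a c → Run (a ∷ st) s n → Run st (c ∷ s) (suc n)
    pop       : ∀ a → Run st s n → Run (a ∷ st) (cl a ∷ s) n
    pop-sub   : ∀ a c → Run st s n → Run (a ∷ st) (c ∷ s) (suc n)
    pop-ins   : ∀ a → Run st s n → Run (a ∷ st) s (suc n)
    pop-resub : ∀ a b → Run st s n → Run (a ∷ b ∷ st) s (suc n)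

  weaken : Run st s n → Run st s (suc n)
  weaken end               = end
  weaken (delete c r)      = delete c (weaken r)
  weaken (push a r)        = push a (weaken r)
  weaken (push-sub a c r)  = push-sub a c (weaken r)
  weaken (pop a r)         = pop a (weaken r)
  weaken (pop-sub a c r)   = pop-sub a c (weaken r)
  weaken (pop-ins a r)     = pop-ins a (weaken r)
  weaken (pop-resub a b r) = pop-resub a b (weaken r)

  weaken-+ : ∀ k → Run st s n → Run st s (k + n)
  weaken-+ zero    r = r
  weaken-+ (suc k) r = weaken (weaken-+ k r)

  -- In these stack lemmas the pop-resub clauses come first, so that st₁ is split before
  -- the run.
  remove-entry : ∀ st₁ → Run (st₁ ++ a ∷ st₂) s n → Run (st₁ ++ st₂) s (suc n)
  remove-entry []            (pop b r)         = delete (cl b) r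
  remove-entry []            (pop-sub b c r)   = weaken (delete c r)
  remove-entry []            (pop-ins b r)     = weaken (weaken r)
  remove-entry []            (pop-resub b e r) = weaken (pop-ins e r)
  remove-entry (_ ∷ [])      (pop-resub b e r) = weaken (pop-ins b r)
  remove-entry (_ ∷ _ ∷ st₁) (pop-resub b e r) = pop-resub b e (remove-entry st₁ r)
  remove-entry st₁           (delete c r)      = delete c (remove-entry st₁ r)
  remove-entry st₁           (push b r)        = push b (remove-entry (b ∷ st₁) r)
  remove-entry st₁           (push-sub b c r)  = push-sub b c (remove-entry (b ∷ st₁) r)
  remove-entry (_ ∷ st₁)     (pop b r)         = pop b (remove-entry st₁ r)
  remove-entry (_ ∷ st₁)     (pop-sub b c r)   = pop-sub b c (remove-entry st₁ r)
  remove-entry (_ ∷ st₁)     (pop-ins b r)     = pop-ins b (remove-entry st₁ r)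

  replace-entry : ∀ st₁ b → Run (st₁ ++ a ∷ st₂) s n → Run (st₁ ++ b ∷ st₂) s (suc n)
  replace-entry []            b (pop a r)         = pop-sub b (cl a) r
  replace-entry []            b (pop-sub a c r)   = weaken (pop-sub b c r)
  replace-entry []            b (pop-ins a r)     = weaken (pop-ins b r)
  replace-entry []            b (pop-resub a e r) = weaken (pop-resub b e r)
  replace-entry (_ ∷ [])      b (pop-resub a e r) = weaken (pop-resub a b r)
  replace-entry (_ ∷ _ ∷ st₁) b (pop-resub a e r) = pop-resub a e (replace-entry st₁ b r)
  replace-entry st₁           b (delete c r)      = delete c (replace-entry st₁ b r)
  replace-entry st₁           b (push a r)        = push a (replace-entry (a ∷ st₁) b r)
  replace-entry st₁           b (push-sub a c r)  = push-sub a c (replace-entry (a ∷ st₁) b r)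
  replace-entry (_ ∷ st₁)     b (pop a r)         = pop a (replace-entry st₁ b r)
  replace-entry (_ ∷ st₁)     b (pop-sub a c r)   = pop-sub a c (replace-entry st₁ b r)
  replace-entry (_ ∷ st₁)     b (pop-ins a r)     = pop-ins a (replace-entry st₁ b r)

  remove-two-entries : ∀ st₁ → Run (st₁ ++ a ∷ b ∷ st₂) s n → Run (st₁ ++ st₂) s (suc n)
  remove-two-entries []            (pop a r)         = push-sub _ (cl a) r
  remove-two-entries []            (pop-sub a c r)   = weaken (push-sub _ c r)
  remove-two-entries []            (pop-ins a r)     = weaken (remove-entry [] r)
  remove-two-entries []            (pop-resub a e r) = weaken (weaken r)
  remove-two-entries (x ∷ [])      (pop-resub a e r) = weaken (replace-entry [] x r)
  remove-two-entries (_ ∷ _ ∷ st₁) (pop-resub a e r) = pop-resub a e (remove-two-entries st₁ r)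
  remove-two-entries st₁           (delete c r)      = delete c (remove-two-entries st₁ r)
  remove-two-entries st₁           (push a r)        = push a (remove-two-entries (a ∷ st₁) r)
  remove-two-entries st₁           (push-sub a c r)  = push-sub a c (remove-two-entries (a ∷ st₁) r)
  remove-two-entries (_ ∷ st₁)     (pop a r)         = pop a (remove-two-entries st₁ r)
  remove-two-entries (_ ∷ st₁)     (pop-sub a c r)   = pop-sub a c (remove-two-entries st₁ r)
  remove-two-entries (_ ∷ st₁)     (pop-ins a r)     = pop-ins a (remove-two-entries st₁ r)

  insert-entry : ∀ st₁ a → Run (st₁ ++ st₂) s n → Run (st₁ ++ a ∷ st₂) s (suc n)
  insert-entry []            a r                 = pop-ins a r
  insert-entry (x ∷ [])      a (pop-resub b e r) = pop-resub x a (pop-ins e r)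
  insert-entry (_ ∷ _ ∷ st₁) a (pop-resub b e r) = pop-resub b e (insert-entry st₁ a r)
  insert-entry (x ∷ st₁)     a (delete c r)      = delete c (insert-entry (x ∷ st₁) a r)
  insert-entry (x ∷ st₁)     a (push b r)        = push b (insert-entry (b ∷ x ∷ st₁) a r)
  insert-entry (x ∷ st₁)     a (push-sub b c r)  = push-sub b c (insert-entry (b ∷ x ∷ st₁) a r)
  insert-entry (_ ∷ st₁)     a (pop b r)         = pop b (insert-entry st₁ a r)
  insert-entry (_ ∷ st₁)     a (pop-sub b c r)   = pop-sub b c (insert-entry st₁ a r)
  insert-entry (_ ∷ st₁)     a (pop-ins b r)     = pop-ins b (insert-entry st₁ a r)

  insert-two-entries : ∀ st₁ a b → Run (st₁ ++ st₂) s n → Run (st₁ ++ a ∷ b ∷ st₂) s (suc n)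
  insert-two-entries []            a b r                 = pop-resub a b r
  insert-two-entries (x ∷ [])      a b (pop-resub d e r) = pop-resub x a (pop-resub b e r)
  insert-two-entries (_ ∷ _ ∷ st₁) a b (pop-resub d e r) = pop-resub d e (insert-two-entries st₁ a b r)
  insert-two-entries (x ∷ st₁)     a b (delete c r)      = delete c (insert-two-entries (x ∷ st₁) a b r)
  insert-two-entries (x ∷ st₁)     a b (push d r)        = push d (insert-two-entries (d ∷ x ∷ st₁) a b r)
  insert-two-entries (x ∷ st₁)     a b (push-sub d c r)  = push-sub d c (insert-two-entries (d ∷ x ∷ st₁) a b r)
  insert-two-entries (_ ∷ st₁)     a b (pop d r)         = pop d (insert-two-entries st₁ a b r)
  insert-two-entries (_ ∷ st₁)     a b (pop-sub d c r)   = pop-sub d c (insert-two-entries st₁ a b r)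
  insert-two-entries (_ ∷ st₁)     a b (pop-ins d r)     = pop-ins d (insert-two-entries st₁ a b r)

  delete-letter : ∀ u → Run st (u ++ c ∷ v) n → Run st (u ++ v) (suc n)
  delete-letter []      (delete c r)      = weaken (weaken r)
  delete-letter []      (push a r)        = remove-entry [] r
  delete-letter []      (push-sub a c r)  = weaken (remove-entry [] r)
  delete-letter []      (pop a r)         = pop-ins a r
  delete-letter []      (pop-sub a c r)   = weaken (pop-ins a r)
  delete-letter u       (pop-ins a r)     = pop-ins a (delete-letter u r)
  delete-letter u       (pop-resub a b r) = pop-resub a b (delete-letter u r)
  delete-letter (_ ∷ u) (delete d r)      = delete d (delete-letter u r)
  delete-letter (_ ∷ u) (push a r)        = push a (delete-letter u r)
  delete-letter (_ ∷ u) (push-sub a d r)  = push-sub a d (delete-letter u r)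
  delete-letter (_ ∷ u) (pop a r)         = pop a (delete-letter u r)
  delete-letter (_ ∷ u) (pop-sub a d r)   = pop-sub a d (delete-letter u r)

  insert-letter : ∀ u c → Run st (u ++ v) n → Run st (u ++ c ∷ v) (suc n)
  insert-letter []      c r                 = delete c r
  insert-letter (x ∷ u) c (pop-ins a r)     = pop-ins a (insert-letter (x ∷ u) c r)
  insert-letter (x ∷ u) c (pop-resub a b r) = pop-resub a b (insert-letter (x ∷ u) c r)
  insert-letter (_ ∷ u) c (delete d r)      = delete d (insert-letter u c r)
  insert-letter (_ ∷ u) c (push a r)        = push a (insert-letter u c r)
  insert-letter (_ ∷ u) c (push-sub a d r)  = push-sub a d (insert-letter u c r)
  insert-letter (_ ∷ u) c (pop a r)         = pop a (insert-letter u c r)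
  insert-letter (_ ∷ u) c (pop-sub a d r)   = pop-sub a d (insert-letter u c r)

  substitute-letter : ∀ u c → Run st (u ++ d ∷ v) n → Run st (u ++ c ∷ v) (suc n)
  substitute-letter []      c (delete e r)      = weaken (delete c r)
  substitute-letter []      c (push a r)        = push-sub a c r
  substitute-letter []      c (push-sub a e r)  = weaken (push-sub a c r)
  substitute-letter []      c (pop a r)         = pop-sub a c r
  substitute-letter []      c (pop-sub a e r)   = weaken (pop-sub a c r)
  substitute-letter u       c (pop-ins a r)     = pop-ins a (substitute-letter u c r)
  substitute-letter u       c (pop-resub a b r) = pop-resub a b (substitute-letter u c r)
  substitute-letter (_ ∷ u) c (delete e r)      = delete e (substitute-letter u c r)
  substitute-letter (_ ∷ u) c (push a r)        = push a (substitute-letter u c r)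
  substitute-letter (_ ∷ u) c (push-sub a e r)  = push-sub a e (substitute-letter u c r)
  substitute-letter (_ ∷ u) c (pop a r)         = pop a (substitute-letter u c r)
  substitute-letter (_ ∷ u) c (pop-sub a e r)   = pop-sub a e (substitute-letter u c r)

  push⁻¹ : Run st (op a ∷ s) n → Run (a ∷ st) s n
  push⁻¹ (delete _ r)      = pop-ins _ r
  push⁻¹ (push a r)        = r
  push⁻¹ (push-sub e _ r)  = replace-entry [] _ r
  push⁻¹ (pop-sub e _ r)   = pop-resub _ e r
  push⁻¹ (pop-ins e r)     = insert-entry (_ ∷ []) e (push⁻¹ r)
  push⁻¹ (pop-resub e f r) = insert-two-entries (_ ∷ []) e f (push⁻¹ r)

  push-sub⁻¹ : ∀ b → Run st (c ∷ s) n → Run (b ∷ st) s (suc n)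
  push-sub⁻¹ b (delete _ r)      = weaken (pop-ins b r)
  push-sub⁻¹ b (push e r)        = replace-entry [] b r
  push-sub⁻¹ b (push-sub e _ r)  = weaken (replace-entry [] b r)
  push-sub⁻¹ b (pop e r)         = pop-resub b e r
  push-sub⁻¹ b (pop-sub e _ r)   = weaken (pop-resub b e r)
  push-sub⁻¹ b (pop-ins e r)     = insert-entry (b ∷ []) e (push-sub⁻¹ b r)
  push-sub⁻¹ b (pop-resub e f r) = insert-two-entries (b ∷ []) e f (push-sub⁻¹ b r)

  pop⁻¹ : Run (a ∷ st) (cl a ∷ s) n → Run st s n
  pop⁻¹ (delete _ r)      = remove-entry [] r
  pop⁻¹ (push-sub e _ r)  = remove-two-entries [] r
  pop⁻¹ (pop _ r)         = r
  pop⁻¹ (pop-sub _ _ r)   = weaken r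
  pop⁻¹ (pop-ins _ r)     = delete-letter [] r
  pop⁻¹ (pop-resub _ e r) = push-sub⁻¹ e r

  pop-sub⁻¹ : Run (a ∷ st) (c ∷ s) n → Run st s (suc n)
  pop-sub⁻¹ (delete _ r)      = weaken (remove-entry [] r)
  pop-sub⁻¹ (push e r)        = remove-two-entries [] r
  pop-sub⁻¹ (push-sub e _ r)  = weaken (remove-two-entries [] r)
  pop-sub⁻¹ (pop _ r)         = weaken r
  pop-sub⁻¹ (pop-sub _ _ r)   = weaken (weaken r)
  pop-sub⁻¹ (pop-ins _ r)     = weaken (delete-letter [] r)
  pop-sub⁻¹ (pop-resub _ e r) = pop-ins e (delete-letter [] r)

  cancel-pair : ∀ u c → Run st (u ++ bar c ∷ c ∷ v) n → Run st (u ++ v) n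
  cancel-pair []      (op a) (delete _ r)      = delete-letter [] r
  cancel-pair []      (op a) (push-sub _ _ r)  = pop-sub⁻¹ r
  cancel-pair []      (op a) (pop a r)         = push⁻¹ r
  cancel-pair []      (op a) (pop-sub b _ r)   = push-sub⁻¹ b r
  cancel-pair []      (cl a) (delete _ r)      = delete-letter [] r
  cancel-pair []      (cl a) (push a r)        = pop⁻¹ r
  cancel-pair []      (cl a) (push-sub _ _ r)  = pop-sub⁻¹ r
  cancel-pair []      (cl a) (pop-sub b _ r)   = push-sub⁻¹ b r
  cancel-pair u       c      (pop-ins a r)     = pop-ins a (cancel-pair u c r)
  cancel-pair u       c      (pop-resub a b r) = pop-resub a b (cancel-pair u c r)
  cancel-pair (_ ∷ u) c      (delete d r)      = delete d (cancel-pair u c r)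
  cancel-pair (_ ∷ u) c      (push a r)        = push a (cancel-pair u c r)
  cancel-pair (_ ∷ u) c      (push-sub a d r)  = push-sub a d (cancel-pair u c r)
  cancel-pair (_ ∷ u) c      (pop a r)         = pop a (cancel-pair u c r)
  cancel-pair (_ ∷ u) c      (pop-sub a d r)   = pop-sub a d (cancel-pair u c r)

  cancel-mirror : ∀ x y → Run st (x ++ barStr y ++ y ++ s) n → Run st (x ++ s) n
  cancel-mirror x []      r = r
  cancel-mirror {st = st} {s = s} {n = n} x (c ∷ y) r =
    cancel-mirror x y (subst (λ w → Run st w n) (++-assoc x (barStr y) (y ++ s))
      (cancel-pair (x ++ barStr y) c (subst (λ w → Run st w n) split r)))
    where
    split : x ++ barStr (c ∷ y) ++ c ∷ y ++ s ≡ (x ++ barStr y) ++ bar c ∷ c ∷ y ++ s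
    split = begin
      x ++ barStr (c ∷ y) ++ c ∷ y ++ s           ≡⟨ cong (λ w → x ++ w ++ c ∷ y ++ s) (unfold-reverse (bar c) (map bar y)) ⟩
      x ++ (barStr y ++ bar c ∷ []) ++ c ∷ y ++ s ≡⟨ cong (x ++_) (++-assoc (barStr y) (bar c ∷ []) (c ∷ y ++ s)) ⟩
      x ++ barStr y ++ bar c ∷ c ∷ y ++ s         ≡⟨ ++-assoc x (barStr y) (bar c ∷ c ∷ y ++ s) ⟨
      (x ++ barStr y) ++ bar c ∷ c ∷ y ++ s       ∎
      where open ≡-Reasoning

  run-++ : Run st u m → Run [] v n → Run st (u ++ v) (m + n)
  run-++ {m = m} end       r′ = weaken-+ m r′
  run-++ (delete c r)      r′ = delete c (run-++ r r′)
  run-++ (push a r)        r′ = push a (run-++ r r′)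
  run-++ (push-sub a c r)  r′ = push-sub a c (run-++ r r′)
  run-++ (pop a r)         r′ = pop a (run-++ r r′)
  run-++ (pop-sub a c r)   r′ = pop-sub a c (run-++ r r′)
  run-++ (pop-ins a r)     r′ = pop-ins a (run-++ r r′)
  run-++ (pop-resub a b r) r′ = pop-resub a b (run-++ r r′)

  dyck-run : Dyck w → Run st s n → Run st (w ++ s) n
  dyck-run dyck-empty r = r
  dyck-run {s = s} (dyck-concat {u} {v} du dv) r
    rewrite ++-assoc u v s = dyck-run du (dyck-run dv r)
  dyck-run {s = s} (dyck-wrap a {u} du) r
    rewrite ++-assoc u (cl a ∷ []) s = push a (dyck-run du (pop a r))

  edits-run : Edits x w k → Run st w m → Run st x (k + m)
  edits-run done                   r = r
  edits-run (step (ins u _ _) e)   r = delete-letter u (edits-run e r)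
  edits-run (step (del u _ c) e)   r = insert-letter u c (edits-run e r)
  edits-run (step (sub u _ c _) e) r = substitute-letter u c (edits-run e r)

  data DyckPrefix : List (Sym T) → List T → Set where
    balanced : Dyck w → DyckPrefix w []
    opened   : ∀ a → DyckPrefix u st → Dyck w → DyckPrefix (u ++ op a ∷ w) (a ∷ st)

  append-dyck : DyckPrefix u st → Dyck w → DyckPrefix (u ++ w) st
  append-dyck (balanced d) dw = balanced (dyck-concat d dw)
  append-dyck {w = w} (opened {u} {w = w₀} a p d) dw
    rewrite ++-assoc u (op a ∷ w₀) w = opened a p (dyck-concat d dw)

  close-top : DyckPrefix u (a ∷ st) → DyckPrefix (u ++ cl a ∷ []) st
  close-top (opened {u} {w = w} a p d)
    rewrite ++-assoc u (op a ∷ w) (cl a ∷ []) = append-dyck p (dyck-wrap a d)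

  DyckWithin : List (Sym T) → ℕ → Set
  DyckWithin x n = ∃₂ λ w k → Dyck w × Edits x w k × k ≤ n

  within-step : EditStep x y → DyckWithin y n → DyckWithin x (suc n)
  within-step e (w , k , dw , es , k≤n) = w , suc k , dw , step e es , s≤s k≤n

  within-snoc : ∀ u c s → DyckWithin ((u ++ c ∷ []) ++ s) n → DyckWithin (u ++ c ∷ s) n
  within-snoc u c s = subst (λ x → DyckWithin x _) (++-assoc u (c ∷ []) s)

  resubstitute : DyckPrefix u (a ∷ b ∷ st) → ∀ s →
                 ∃ λ u′ → DyckPrefix u′ st × EditStep (u ++ s) (u′ ++ s)
  resubstitute (opened {u} {w = w} a p@(opened b _ _) dw) s =
    u ++ cl b ∷ w ,
    subst (λ x → DyckPrefix x _) (++-assoc u (cl b ∷ []) w) (append-dyck (close-top p) dw) ,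
    subst₂ EditStep (sym (++-assoc u (op a ∷ w) s)) (sym (++-assoc u (cl b ∷ w) s))
      (sub u (w ++ s) (op a) (cl b))

  run-within : Run st s n → DyckPrefix u st → DyckWithin (u ++ s) n
  run-within {u = u} end (balanced d) rewrite ++-identityʳ u = u , 0 , d , done , z≤n
  run-within {s = c ∷ s} {u = u} (delete c r) p = within-step (del u s c) (run-within r p)
  run-within {s = _ ∷ s} {u = u} (push a r) p = within-snoc u (op a) s (run-within r (opened a p dyck-empty))
  run-within {s = c ∷ s} {u = u} (push-sub a c r) p =
    within-step (sub u s c (op a)) (within-snoc u (op a) s (run-within r (opened a p dyck-empty)))
  run-within {s = _ ∷ s} {u = u} (pop a r) p = within-snoc u (cl a) s (run-within r (close-top p))
  run-within {s = c ∷ s} {u = u} (pop-sub a c r) p =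
    within-step (sub u s c (cl a)) (within-snoc u (cl a) s (run-within r (close-top p)))
  run-within {s = s} {u = u} (pop-ins a r) p =
    within-step (ins u s (cl a)) (within-snoc u (cl a) s (run-within r (close-top p)))
  run-within {s = s} (pop-resub _ _ r) p with resubstitute p s
  ... | u′ , p′ , e = within-step e (run-within r p′)

  dist-≤-cost : IsDyckDist s k → Run [] s n → k ≤ n
  dist-≤-cost (_ , minimal) r with run-within r (balanced dyck-empty)
  ... | w , m , dw , e , m≤n = ≤-trans (minimal w m dw e) m≤n

  run-at-dist : IsDyckDist s k → Run [] s k
  run-at-dist {k = k} ((w , dw , e) , _) =
    subst (Run [] _) (+-identityʳ k)
      (edits-run e (subst (λ x → Run [] x 0) (++-identityʳ w) (dyck-run dw end)))

lemma2p3 : {T : Set} (x y z : List (Sym T)) (d₁ d₂ d₃ d₄ : ℕ) →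
    IsDyckDist (x ++ barStr z) d₁ →
    IsDyckDist (x ++ barStr y ++ y ++ barStr z) d₂ →
    IsDyckDist (x ++ barStr y) d₃ →
    IsDyckDist (y ++ barStr z) d₄ →
    d₁ ≤ d₂ × d₂ ≤ d₃ + d₄
lemma2p3 x y z d₁ d₂ d₃ d₄ h₁ h₂ h₃ h₄ =
    dist-≤-cost h₁ (cancel-mirror x y (run-at-dist h₂))
  , dist-≤-cost h₂ (subst (λ w → Run [] w (d₃ + d₄)) (++-assoc x (barStr y) (y ++ barStr z))
                     (run-++ (run-at-dist h₃) (run-at-dist h₄)))
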